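{- Let $E$ be a system of $m$ equations $x_i=_{\eta_i}f_i(x_1,\ldots,x_m)$ ($i=1,\ldots,m$) over a complete lattice $L$, and let $\vec{u}=(u_1,\ldots,u_m)$ be a compatible tuple of up-to functions for $E$. Let $E^{\vec u}$ be the system of $2m$ equations in the variables $y_1,\ldots,y_m,x_1,\ldots,x_m$ (in this order) given by $$y_i=_\mu u_i(y_i)\sqcup x_i\quad(i=1,\ldots,m),\qquad x_i=_{\eta_i}f_i(y_1,\ldots,y_m)\quad(i=1,\ldots,m).$$ Then the solution of $E^{\vec u}$ is $(\mathrm{sol}(E),\mathrm{sol}(E))\in L^{2m}$.
   Context: A system of equations over $L$: a list $z_k=_{\eta_k}g_k(z_1,\ldots,z_n)$ with monotone $g_k\colon L^n\to L$ and $\eta_k\in\{\mu,\nu\}$. $E[z_k:=l]$ removes the $k$-th equation and substitutes $l$ for $z_k$ elsewhere. Solution: $\mathrm{sol}(\emptyset)=()$, $\mathrm{sol}(E)=(\mathrm{sol}(E[z_n:=s_n]),s_n)$ with $s_n=\eta_n(\lambda z.\,g_n(\mathrm{sol}(E[z_n:=z]),z))$, where $\mu,\nu$ are least/greatest fixpoints. A compatible tuple of up-to functions for $E$ is an $m$-tuple of monotone $u_i\colon L\to L$ with $(u_1(f_1(\vec x)),\ldots,u_m(f_m(\vec x)))\sqsubseteq(f_1(u_1(x_1),\ldots,u_m(x_m)),\ldots,f_m(u_1(x_1),\ldots,u_m(x_m)))$ pointwise for all $\vec x\in L^m$, with $u_i$ continuous (preserving directed joins) and strict (preserving $\bot$)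 for each $i$ with $\eta_i=\mu$. -}

module Defs where

open import Level using (Level; _⊔_; Lift; lift) renaming (suc to lsuc)
open import Data.Nat using (ℕ; zero; suc; _+_)
open import Data.Fin using (Fin; zero; suc; inject₁; fromℕ; splitAt)
open import Data.Sum using (inj₁; inj₂)
open import Data.Product using (Σ; _×_; _,_; proj₁)
open import Data.Bool using (Bool; true; false)
open import Data.Empty using (⊥)
open import Data.Vec.Functional using (Vector; take; drop)
open import Relation.Binary.Bundles using (Poset)
open import Relation.Binary.PropositionalEquality using (_≡_)

-- Complete lattices: a poset with joins and meets of all families
-- indexed by types of level (c ⊔ ℓ₁ ⊔ ℓ₂) (this covers all subsets
-- given as predicates on the carrier).

record CompleteLattice (c ℓ₁ ℓ₂ : Level) : Set (lsuc (c ⊔ ℓ₁ ⊔ ℓ₂)) where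
  field
    poset : Poset c ℓ₁ ℓ₂
  open Poset poset public
  field
    ⋁ : {I : Set (c ⊔ ℓ₁ ⊔ ℓ₂)} → (I → Carrier) → Carrier
    ⋁-upper : {I : Set (c ⊔ ℓ₁ ⊔ ℓ₂)} (d : I → Carrier) (i : I) → d i ≤ ⋁ d
    ⋁-least : {I : Set (c ⊔ ℓ₁ ⊔ ℓ₂)} (d : I → Carrier) (b : Carrier) →
              (∀ i → d i ≤ b) → ⋁ d ≤ b
    ⋀ : {I : Set (c ⊔ ℓ₁ ⊔ ℓ₂)} → (I → Carrier) → Carrier
    ⋀-lower : {I : Set (c ⊔ ℓ₁ ⊔ ℓ₂)} (d : I → Carrier) (i : I) → ⋀ d ≤ d i
    ⋀-greatest : {I : Set (c ⊔ ℓ₁ ⊔ ℓ₂)} (d : I → Carrier) (b : Carrier) →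
                 (∀ i → b ≤ d i) → b ≤ ⋀ d

module _ {c ℓ₁ ℓ₂ : Level} (L : CompleteLattice c ℓ₁ ℓ₂) where
  open CompleteLattice L

  ⊥L : Carrier
  ⊥L = ⋁ {I = Lift (c ⊔ ℓ₁ ⊔ ℓ₂) ⊥} (λ ())

  _⊔L_ : Carrier → Carrier → Carrier
  x ⊔L y = ⋁ {I = Lift (c ⊔ ℓ₁ ⊔ ℓ₂) Bool} λ { (lift true) → x ; (lift false) → y }

  Monotone : (Carrier → Carrier) → Set (c ⊔ ℓ₂)
  Monotone g = ∀ {x y} → x ≤ y → g x ≤ g y

  MonotoneN : {n : ℕ} → (Vector Carrier n → Carrier) → Set (c ⊔ ℓ₂)
  MonotoneN g = ∀ {x y} → (∀ i → x i ≤ y i) → g x ≤ g y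

  Directed : {I : Set (c ⊔ ℓ₁ ⊔ ℓ₂)} → (I → Carrier) → Set (c ⊔ ℓ₁ ⊔ ℓ₂)
  Directed {I} d = I × (∀ i j → Σ I λ k → d i ≤ d k × d j ≤ d k)

  Continuous : (Carrier → Carrier) → Set (lsuc (c ⊔ ℓ₁ ⊔ ℓ₂))
  Continuous g = ∀ {I : Set (c ⊔ ℓ₁ ⊔ ℓ₂)} (d : I → Carrier) →
                 Directed d → g (⋁ d) ≈ ⋁ (λ i → g (d i))

  Strict : (Carrier → Carrier) → Set ℓ₁
  Strict g = g ⊥L ≈ ⊥L

  lfp : (Carrier → Carrier) → Carrier
  lfp g = ⋀ {I = Lift (c ⊔ ℓ₁ ⊔ ℓ₂) (Σ Carrier λ x → g x ≤ x)}
            (λ p → proj₁ (Level.lower p))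

  gfp : (Carrier → Carrier) → Carrier
  gfp g = ⋁ {I = Lift (c ⊔ ℓ₁ ⊔ ℓ₂) (Σ Carrier λ x → x ≤ g x)}
            (λ p → proj₁ (Level.lower p))

data FP : Set where
  μ ν : FP

module _ {c ℓ₁ ℓ₂ : Level} (L : CompleteLattice c ℓ₁ ℓ₂) where
  open CompleteLattice L

  fixpoint : FP → (Carrier → Carrier) → Carrier
  fixpoint μ g = lfp L g
  fixpoint ν g = gfp L g

  snoc : {n : ℕ} → Vector Carrier n → Carrier → Vector Carrier (suc n)
  snoc {zero}  v a zero    = a
  snoc {suc n} v a zero    = v zero
  snoc {suc n} v a (suc i) = snoc (λ j → v (suc j)) a i

  -- A system of n equations z_k =_{η k} g k (z_1 .. z_n) is given by
  -- η : Fin n → FP and g : Fin n → (L^n → L).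
  -- Substitution E[z_n := l] of the LAST variable:
  substLast : {n : ℕ} → (Fin (suc n) → Vector Carrier (suc n) → Carrier) →
              Carrier → Fin n → Vector Carrier n → Carrier
  substLast g l k x = g (inject₁ k) (snoc x l)

  sol : (n : ℕ) → (Fin n → FP) → (Fin n → Vector Carrier n → Carrier) →
        Vector Carrier n
  sol zero    η g ()
  sol (suc n) η g = snoc (sol n η' (substLast g s)) s
    where
    η' : Fin n → FP
    η' k = η (inject₁ k)
    s : Carrier
    s = fixpoint (η (fromℕ n))
          (λ z → g (fromℕ n) (snoc (sol n η' (substLast g z)) z))

  record Compatible (m : ℕ) (η : Fin m → FP)
         (f : Fin m → Vector Carrier m → Carrier)
         (u : Fin m → Carrier → Carrier) : Set (lsuc (c ⊔ ℓ₁ ⊔ ℓ₂)) where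
    field
      u-mono   : ∀ i → Monotone L (u i)
      compat   : ∀ (x : Vector Carrier m) i →
                 u i (f i x) ≤ f i (λ j → u j (x j))
      u-cont   : ∀ i → η i ≡ μ → Continuous L (u i)
      u-strict : ∀ i → η i ≡ μ → Strict L (u i)

  upη : (m : ℕ) → (Fin m → FP) → Fin (m + m) → FP
  upη m η k with splitAt m k
  ... | inj₁ i = μ
  ... | inj₂ i = η i

  upf : (m : ℕ) → (Fin m → Vector Carrier m → Carrier) →
        (Fin m → Carrier → Carrier) →
        Fin (m + m) → Vector Carrier (m + m) → Carrier
  upf m f u k v with splitAt m k
  ... | inj₁ i = _⊔L_ L (u i (take m v i)) (drop m v i)
  ... | inj₂ i = f i (take m v)

module Submission where

-- Bekič's lemma splits the solution of E^u into the solution X of the x-block of the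
-- reduced system x = f(ū(x)), and y = ū(X), where ū_i(a) = lfp(z ↦ u_i z ⊔ a) is the
-- least u_i-closed element above a (the y-equations are decoupled and all least).
-- It then suffices that sol(f ∘ ū) = sol(f) and that sol(f) is u-closed. Both come
-- from pushing u through the nested fixpoints of sol by compatibility: through greatest
-- fixpoints this needs only monotonicity, through least ones continuity and strictness
-- (by Pataraia's fixpoint argument). Then f ∘ ū agrees with f on u-closed vectors,
-- which gives sol(f ∘ ū) ≤ sol(f); the converse is monotonicity of sol.

open import Defs
open import Level using (Level; _⊔_; Lift; lift; lower)
open import Data.Bool using (true; false)
open import Data.Nat using (ℕ; zero; suc; _+_)
open import Data.Nat.Properties using (+-suc; +-identityʳ)
open import Data.Fin using (Fin; zero; suc; inject₁; fromℕ; toℕ; cast; splitAt; _↑ˡ_; _↑ʳ_)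
open import Data.Fin.Properties
  using (toℕ-injective; toℕ-cast; cast-is-id; cast-involutive; toℕ-inject₁; toℕ-fromℕ; toℕ-↑ˡ; toℕ-↑ʳ;
         splitAt⁻¹-↑ˡ; splitAt⁻¹-↑ʳ; splitAt-↑ˡ; splitAt-↑ʳ)
open import Data.Sum using (inj₁; inj₂)
open import Data.Vec.Functional using (Vector; _++_; take; drop)
open import Data.Vec.Functional.Properties using (lookup-++ˡ; lookup-++ʳ)
open import Data.Vec.Functional.Relation.Binary.Pointwise using (Pointwise)
open import Data.Vec.Functional.Relation.Binary.Pointwise.Properties using (++⁺)
open import Data.Product using (Σ; Σ-syntax; _×_; _,_; proj₁; proj₂)
open import Function using (id; _∘_)
open import Relation.Binary.PropositionalEquality as ≡ using (_≡_; _≗_)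

↑-elim : ∀ a {b p} (Q : Fin (a + b) → Set p) → (∀ i → Q (i ↑ˡ b)) → (∀ j → Q (a ↑ʳ j)) → ∀ k → Q k
↑-elim a Q Q-left Q-right k with splitAt a k in eq
... | inj₁ i = ≡.subst Q (splitAt⁻¹-↑ˡ eq) (Q-left i)
... | inj₂ j = ≡.subst Q (splitAt⁻¹-↑ʳ eq) (Q-right j)

cast-toℕ : ∀ {m n} .(e : m ≡ n) {i : Fin m} {j : Fin n} → toℕ i ≡ toℕ j → cast e i ≡ j
cast-toℕ e {i} toℕi≡toℕj = toℕ-injective (≡.trans (toℕ-cast e i) toℕi≡toℕj)

module Fixpoints {c ℓ₁ ℓ₂ : Level} (L : CompleteLattice c ℓ₁ ℓ₂) where
  open CompleteLattice L

  _∨_ : Carrier → Carrier → Carrier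
  _∨_ = _⊔L_ L

  ⊥L-least : ∀ x → ⊥L L ≤ x
  ⊥L-least x = ⋁-least _ x λ ()

  x≤x∨y : ∀ x y → x ≤ x ∨ y
  x≤x∨y x y = ⋁-upper _ (lift true)

  y≤x∨y : ∀ x y → y ≤ x ∨ y
  y≤x∨y x y = ⋁-upper _ (lift false)

  ∨-least : ∀ {x y z} → x ≤ z → y ≤ z → x ∨ y ≤ z
  ∨-least x≤z y≤z = ⋁-least _ _ λ { (lift true) → x≤z ; (lift false) → y≤z }

  ∨-mono : ∀ {x x′ y y′} → x ≤ x′ → y ≤ y′ → x ∨ y ≤ x′ ∨ y′
  ∨-mono x≤x′ y≤y′ = ∨-least (trans x≤x′ (x≤x∨y _ _)) (trans y≤y′ (y≤x∨y _ _))

  module _ (h : Carrier → Carrier) where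

    lfp-least : ∀ {x} → h x ≤ x → lfp L h ≤ x
    lfp-least {x} hx≤x = ⋀-lower _ (lift (x , hx≤x))

    gfp-greatest : ∀ {x} → x ≤ h x → x ≤ gfp L h
    gfp-greatest {x} x≤hx = ⋁-upper _ (lift (x , x≤hx))

    module _ (h-mono : Monotone L h) where

      lfp-prefixed : h (lfp L h) ≤ lfp L h
      lfp-prefixed = ⋀-greatest _ _ λ { (lift (x , hx≤x)) → trans (h-mono (lfp-least hx≤x)) hx≤x }

      lfp-postfixed : lfp L h ≤ h (lfp L h)
      lfp-postfixed = lfp-least (h-mono lfp-prefixed)

      gfp-postfixed : gfp L h ≤ h (gfp L h)
      gfp-postfixed = ⋁-least _ _ λ { (lift (x , x≤hx)) → trans x≤hx (h-mono (gfp-greatest x≤hx)) }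

      gfp-prefixed : h (gfp L h) ≤ gfp L h
      gfp-prefixed = gfp-greatest (h-mono gfp-postfixed)

      fixpoint-unfold : ∀ e → fixpoint L e h ≈ h (fixpoint L e h)
      fixpoint-unfold μ = antisym lfp-postfixed lfp-prefixed
      fixpoint-unfold ν = antisym gfp-postfixed gfp-prefixed

  fixpoint-mono : ∀ e {h h′ : Carrier → Carrier} → (∀ z → h z ≤ h′ z) → fixpoint L e h ≤ fixpoint L e h′
  fixpoint-mono μ {h} {h′} h≤h′ =
    ⋀-greatest _ _ λ { (lift (x , h′x≤x)) → lfp-least h (trans (h≤h′ x) h′x≤x) }
  fixpoint-mono ν {h} {h′} h≤h′ =
    ⋁-least _ _ λ { (lift (x , x≤hx)) → gfp-greatest h′ (trans x≤hx (h≤h′ x)) }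

  fixpoint-cong : ∀ e {h h′ : Carrier → Carrier} → (∀ z → h z ≈ h′ z) → fixpoint L e h ≈ fixpoint L e h′
  fixpoint-cong e h≈h′ =
    antisym (fixpoint-mono e (reflexive ∘ h≈h′)) (fixpoint-mono e (reflexive ∘ Eq.sym ∘ h≈h′))

  fixpoint-mono-on : ∀ e {p} (P : Carrier → Set p) {h h′ : Carrier → Carrier} →
                     Monotone L h → Monotone L h′ → (∀ z → P z → h z ≤ h′ z) →
                     P (fixpoint L e h) → P (fixpoint L e h′) → fixpoint L e h ≤ fixpoint L e h′
  fixpoint-mono-on μ P {h} {h′} h-mono h′-mono h≤h′ _ P-lfph′ =
    lfp-least h (trans (h≤h′ _ P-lfph′) (lfp-prefixed h′ h′-mono))
  fixpoint-mono-on ν P {h} {h′} h-mono h′-mono h≤h′ P-gfph _ =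
    gfp-greatest h′ (trans (gfp-postfixed h h-mono) (h≤h′ _ P-gfph))

  LfpInductive : (Carrier → Carrier) → Set (c ⊔ ℓ₂)
  LfpInductive w = ∀ h → Monotone L h → ∀ b → (∀ z → w z ≤ b → w (h z) ≤ b) → w (lfp L h) ≤ b

  fixpoint-transfer : ∀ e {w h h′ : Carrier → Carrier} → Monotone L w → (e ≡ μ → LfpInductive w) →
                      Monotone L h → Monotone L h′ → (∀ {z z′} → w z ≤ z′ → w (h z) ≤ h′ z′) →
                      w (fixpoint L e h) ≤ fixpoint L e h′
  fixpoint-transfer μ {h = h} {h′} _ w-inductive h-mono h′-mono w∘h≤h′ =
    w-inductive ≡.refl h h-mono _ λ _ wz≤lfp → trans (w∘h≤h′ wz≤lfp) (lfp-prefixed h′ h′-mono)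
  fixpoint-transfer ν {h = h} {h′} w-mono _ h-mono _ w∘h≤h′ =
    gfp-greatest h′ (trans (w-mono (gfp-postfixed h h-mono)) (w∘h≤h′ refl))

  module Pataraia (h : Carrier → Carrier) (h-mono : Monotone L h) (P : Carrier → Set ℓ₂)
                  (P-h : ∀ {y} → P y → P (h y))
                  (P-⋁ : ∀ {I : Set (c ⊔ ℓ₁ ⊔ ℓ₂)} (d : I → Carrier) → Directed L d →
                         (∀ i → P (d i)) → P (⋁ d)) where

    Q : Carrier → Set ℓ₂
    Q y = y ≤ h y × P y

    record Progressive (F : Carrier → Carrier) : Set (c ⊔ ℓ₂) where
      field
        monotone     : Monotone L F
        preserves    : ∀ {y} → Q y → Q (F y)
        inflationary : ∀ {y} → Q y → y ≤ F y
    open Progressive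

    Progression : Set (c ⊔ ℓ₁ ⊔ ℓ₂)
    Progression = Lift (c ⊔ ℓ₁ ⊔ ℓ₂) (Σ (Carrier → Carrier) Progressive)

    apply : Progression → Carrier → Carrier
    apply F = proj₁ (lower F)

    id-progressive : Progressive id
    id-progressive = record { monotone = id ; preserves = id ; inflationary = λ _ → refl }

    ∘-progressive : ∀ {F G} → Progressive F → Progressive G → Progressive (F ∘ G)
    ∘-progressive F G = record
      { monotone     = monotone F ∘ monotone G
      ; preserves    = preserves F ∘ preserves G
      ; inflationary = λ Qy → trans (inflationary G Qy) (inflationary F (preserves G Qy))
      }

    progressions-directed : ∀ {y} → Q y → Directed L (λ F → apply F y)
    progressions-directed Qy =
      lift (id , id-progressive) ,
      λ { (lift (F , F-prog)) (lift (G , G-prog)) →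
            lift (F ∘ G , ∘-progressive F-prog G-prog) ,
            monotone F-prog (inflationary G-prog Qy) ,
            inflationary F-prog (preserves G-prog Qy) }

    -- Pataraia's argument: the join Φ of all progressive maps is itself progressive,
    -- so h ∘ Φ ≤ Φ, and no transfinite iteration of h is needed.
    Φ : Carrier → Carrier
    Φ y = ⋁ (λ F → apply F y)

    Φ-progressive : Progressive Φ
    Φ-progressive = record
      { monotone     = λ y≤y′ → ⋁-least _ _ λ F →
                         trans (monotone (proj₂ (lower F)) y≤y′) (⋁-upper _ F)
      ; preserves    = λ Qy →
                         ⋁-least _ _ (λ F → trans (proj₁ (preserves (proj₂ (lower F)) Qy))
                                                  (h-mono (⋁-upper _ F))) ,
                         P-⋁ _ (progressions-directed Qy) (λ F → proj₂ (preserves (proj₂ (lower F)) Qy))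
      ; inflationary = λ _ → ⋁-upper _ (lift (id , id-progressive))
      }

    h-progressive : Progressive h
    h-progressive = record
      { monotone     = h-mono
      ; preserves    = λ { (y≤hy , Py) → h-mono y≤hy , P-h Py }
      ; inflationary = proj₁
      }

    Φ-absorbs-h : ∀ y → h (Φ y) ≤ Φ y
    Φ-absorbs-h y = ⋁-upper _ (lift (h ∘ Φ , ∘-progressive h-progressive Φ-progressive))

  admissible-prefixedPoint :
    (h : Carrier → Carrier) → Monotone L h → (P : Carrier → Set ℓ₂) → P (⊥L L) →
    (∀ {y} → P y → P (h y)) →
    (∀ {I : Set (c ⊔ ℓ₁ ⊔ ℓ₂)} (d : I → Carrier) → Directed L d → (∀ i → P (d i)) → P (⋁ d)) →
    Σ[ t ∈ Carrier ] P t × h t ≤ t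
  admissible-prefixedPoint h h-mono P P-⊥ P-h P-⋁ =
    Φ (⊥L L) , proj₂ (Progressive.preserves Φ-progressive (⊥L-least _ , P-⊥)) , Φ-absorbs-h (⊥L L)
    where open Pataraia h h-mono P P-h P-⋁

  continuous-strict⇒lfpInductive : ∀ {w} → Monotone L w → Continuous L w → Strict L w → LfpInductive w
  continuous-strict⇒lfpInductive {w} w-mono w-continuous w-strict h h-mono b w∘h≤b
    with admissible-prefixedPoint h h-mono (λ z → w z ≤ b) w⊥≤b (w∘h≤b _) w⋁≤b
    where
    w⊥≤b : w (⊥L L) ≤ b
    w⊥≤b = trans (reflexive w-strict) (⊥L-least b)
    w⋁≤b : ∀ {I : Set (c ⊔ ℓ₁ ⊔ ℓ₂)} (d : I → Carrier) → Directed L d →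
           (∀ i → w (d i) ≤ b) → w (⋁ d) ≤ b
    w⋁≤b d d-directed wd≤b = trans (reflexive (w-continuous d d-directed)) (⋁-least _ _ wd≤b)
  ... | t , wt≤b , ht≤t = trans (w-mono (lfp-least h ht≤t)) wt≤b

  closure : (Carrier → Carrier) → Carrier → Carrier
  closure u a = lfp L (λ z → u z ∨ a)

  module _ {u : Carrier → Carrier} (u-mono : Monotone L u) where

    closure-unfold : ∀ a → u (closure u a) ∨ a ≤ closure u a
    closure-unfold a = lfp-prefixed _ (λ z≤z′ → ∨-mono (u-mono z≤z′) refl)

    closure-inflationary : ∀ a → a ≤ closure u a
    closure-inflationary a = trans (y≤x∨y _ _) (closure-unfold a)

    closure-closed : ∀ a → u (closure u a) ≤ closure u a
    closure-closed a = trans (x≤x∨y _ _) (closure-unfold a)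

  closure-least : ∀ {u a b} → a ≤ b → u b ≤ b → closure u a ≤ b
  closure-least a≤b ub≤b = lfp-least _ (∨-least ub≤b a≤b)

  closure-mono : ∀ {u a a′} → a ≤ a′ → closure u a ≤ closure u a′
  closure-mono a≤a′ = fixpoint-mono μ λ _ → ∨-mono refl a≤a′

  closure-cong : ∀ {u a a′} → a ≈ a′ → closure u a ≈ closure u a′
  closure-cong a≈a′ = antisym (closure-mono (reflexive a≈a′)) (closure-mono (reflexive (Eq.sym a≈a′)))

  closure-of-closed : ∀ {u a} → Monotone L u → u a ≤ a → closure u a ≈ a
  closure-of-closed u-mono ua≤a = antisym (closure-least refl ua≤a) (closure-inflationary u-mono _)

module Solutions {c ℓ₁ ℓ₂ : Level} (L : CompleteLattice c ℓ₁ ℓ₂) where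
  open CompleteLattice L
  open Fixpoints L

  snoc-pointwise : ∀ {n r} (R : Fin (suc n) → Carrier → Carrier → Set r) {v v′ : Vector Carrier n} {a a′} →
                   R (fromℕ n) a a′ → (∀ k → R (inject₁ k) (v k) (v′ k)) →
                   ∀ i → R i (snoc L v a i) (snoc L v′ a′ i)
  snoc-pointwise {zero}  R Ra _  zero    = Ra
  snoc-pointwise {suc n} R _  Rv zero    = Rv zero
  snoc-pointwise {suc n} R {v} {v′} Ra Rv (suc i) =
    snoc-pointwise (R ∘ suc) {v ∘ suc} {v′ ∘ suc} Ra (Rv ∘ suc) i

  snoc-all : ∀ {n r} (Q : Fin (suc n) → Carrier → Set r) {v : Vector Carrier n} {a} →
             Q (fromℕ n) a → (∀ k → Q (inject₁ k) (v k)) → ∀ i → Q i (snoc L v a i)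
  snoc-all Q {v} {a} = snoc-pointwise (λ k b _ → Q k b) {v} {v} {a} {a}

  snoc-last : ∀ {n} (v : Vector Carrier n) a → snoc L v a (fromℕ n) ≡ a
  snoc-last {zero}  v a = ≡.refl
  snoc-last {suc n} v a = snoc-last (v ∘ suc) a

  snoc-inject₁ : ∀ {n} (v : Vector Carrier n) a k → snoc L v a (inject₁ k) ≡ v k
  snoc-inject₁ {suc n} v a zero    = ≡.refl
  snoc-inject₁ {suc n} v a (suc k) = snoc-inject₁ (v ∘ suc) a k

  System : ℕ → Set c
  System n = Fin n → Vector Carrier n → Carrier

  _≤ⁿ_ : ∀ {n} → Vector Carrier n → Vector Carrier n → Set ℓ₂
  _≤ⁿ_ = Pointwise _≤_

  _≈ⁿ_ : ∀ {n} → Vector Carrier n → Vector Carrier n → Set ℓ₁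
  _≈ⁿ_ = Pointwise _≈_

  Simulation : ∀ {n} → (Fin n → Carrier → Carrier) → System n → System n → Set (c ⊔ ℓ₂)
  Simulation w g g′ = ∀ i {x y} → (∀ j → w j (x j) ≤ y j) → w i (g i x) ≤ g′ i y

  -- g ⊑ g is exactly monotonicity of every right-hand side of g.
  _⊑_ : ∀ {n} → System n → System n → Set (c ⊔ ℓ₂)
  g ⊑ g′ = Simulation (λ _ → id) g g′

  Closed : ∀ {n} → (Fin n → Carrier → Carrier) → Vector Carrier n → Set ℓ₂
  Closed u x = ∀ j → u j (x j) ≤ x j

  module _ {n : ℕ} (η : Fin (suc n) → FP) (g : System (suc n)) where

    restSol : Carrier → Vector Carrier n
    restSol z = sol L n (η ∘ inject₁) (substLast L g z)

    lastRhs : Carrier → Carrier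
    lastRhs z = g (fromℕ n) (snoc L (restSol z) z)

    lastSol : Carrier
    lastSol = fixpoint L (η (fromℕ n)) lastRhs

    sol-last : sol L (suc n) η g (fromℕ n) ≡ lastSol
    sol-last = snoc-last (restSol lastSol) lastSol

  substLast-simulation : ∀ {n} {w : Fin (suc n) → Carrier → Carrier} {g g′ : System (suc n)} {z z′} →
                         Simulation w g g′ → w (fromℕ n) z ≤ z′ →
                         Simulation (w ∘ inject₁) (substLast L g z) (substLast L g′ z′)
  substLast-simulation {w = w} g≲g′ wz≤z′ i wx≤y =
    g≲g′ (inject₁ i) (snoc-pointwise (λ j a b → w j a ≤ b) wz≤z′ wx≤y)

  substLast-mono : ∀ {n} {g : System (suc n)} → g ⊑ g → ∀ z → substLast L g z ⊑ substLast L g z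
  substLast-mono g-mono z = substLast-simulation {w = λ _ → id} g-mono refl

  sol-mono : ∀ {n} {η η′ : Fin n → FP} {g g′ : System n} → η ≗ η′ → g ⊑ g′ →
             sol L n η g ≤ⁿ sol L n η′ g′
  sol-mono {zero}  _ _ ()
  sol-mono {suc n} {η} {η′} {g} {g′} η≗η′ g⊑g′ = snoc-pointwise (λ _ → _≤_) last≤ (rest≤ last≤)
    where
    rest≤ : ∀ {z z′} → z ≤ z′ → restSol η g z ≤ⁿ restSol η′ g′ z′
    rest≤ z≤z′ = sol-mono {η = η ∘ inject₁} {η′ ∘ inject₁} (η≗η′ ∘ inject₁)
                   (substLast-simulation {w = λ _ → id} g⊑g′ z≤z′)
    last≤ : lastSol η g ≤ lastSol η′ g′
    last≤ = ≡.subst (λ e → lastSol η g ≤ fixpoint L e (lastRhs η′ g′)) (η≗η′ (fromℕ n))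
              (fixpoint-mono (η (fromℕ n)) λ z →
                 g⊑g′ (fromℕ n) (snoc-pointwise (λ _ → _≤_) refl (rest≤ refl)))

  module _ {n : ℕ} (η : Fin (suc n) → FP) {g : System (suc n)} (g-mono : g ⊑ g) where

    restSol-mono : ∀ {z z′} → z ≤ z′ → restSol η g z ≤ⁿ restSol η g z′
    restSol-mono z≤z′ = sol-mono (λ _ → ≡.refl) (substLast-simulation {w = λ _ → id} g-mono z≤z′)

    lastRhs-mono : Monotone L (lastRhs η g)
    lastRhs-mono z≤z′ = g-mono (fromℕ n) (snoc-pointwise (λ _ → _≤_) z≤z′ (restSol-mono z≤z′))

  restSol-cong : ∀ {n} (η : Fin (suc n) → FP) {g : System (suc n)} → g ⊑ g →
                 ∀ {z z′} → z ≈ z′ → restSol η g z ≈ⁿ restSol η g z′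
  restSol-cong η g-mono z≈z′ k =
    antisym (restSol-mono η g-mono (reflexive z≈z′) k)
            (restSol-mono η g-mono (reflexive (Eq.sym z≈z′)) k)

  rhs-cong : ∀ {n} {g : System n} → g ⊑ g → ∀ {i j x y} → i ≡ j → x ≈ⁿ y → g i x ≈ g j y
  rhs-cong g-mono ≡.refl x≈y =
    antisym (g-mono _ (reflexive ∘ x≈y)) (g-mono _ (reflexive ∘ Eq.sym ∘ x≈y))

  sol-cong : ∀ {n} {η η′ : Fin n → FP} {g g′ : System n} → η ≗ η′ → g ⊑ g →
             (∀ i x → g i x ≈ g′ i x) → sol L n η g ≈ⁿ sol L n η′ g′
  sol-cong {g = g} {g′} η≗η′ g-mono g≈g′ k =
    antisym (sol-mono η≗η′ g⊑g′ k) (sol-mono (≡.sym ∘ η≗η′) g′⊑g k)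
    where
    g⊑g′ : g ⊑ g′
    g⊑g′ i x≤y = trans (g-mono i x≤y) (reflexive (g≈g′ i _))
    g′⊑g : g′ ⊑ g
    g′⊑g i x≤y = trans (reflexive (Eq.sym (g≈g′ i _))) (g-mono i x≤y)

  sol-isSolution : ∀ {n η} {g : System n} → g ⊑ g → ∀ k → sol L n η g k ≈ g k (sol L n η g)
  sol-isSolution {zero}  _ ()
  sol-isSolution {suc n} {η} {g} g-mono =
    snoc-all (λ k a → a ≈ g k (sol L (suc n) η g))
      (fixpoint-unfold (lastRhs η g) (lastRhs-mono η g-mono) (η (fromℕ n)))
      (sol-isSolution {η = η ∘ inject₁} (substLast-mono g-mono _))

  sol-closed : ∀ {n η} {g : System n} {u : Fin n → Carrier → Carrier} → g ⊑ g →
               (∀ i → Monotone L (u i)) → (∀ i x → u i (g i x) ≤ g i x) → Closed u (sol L n η g)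
  sol-closed g-mono u-mono g-closed k =
    trans (u-mono k (reflexive (sol-isSolution g-mono k)))
          (trans (g-closed k _) (reflexive (Eq.sym (sol-isSolution g-mono k))))

  sol-transfer : ∀ {n η} {g g′ : System n} {w : Fin n → Carrier → Carrier} → g ⊑ g → g′ ⊑ g′ →
                 (∀ i → Monotone L (w i)) → (∀ i → η i ≡ μ → LfpInductive (w i)) →
                 Simulation w g g′ → ∀ k → w k (sol L n η g k) ≤ sol L n η g′ k
  sol-transfer {zero} _ _ _ _ _ ()
  sol-transfer {suc n} {η} {g} {g′} {w} g-mono g′-mono w-mono w-inductive g≲g′ =
    snoc-pointwise (λ k a b → w k a ≤ b) last-transfer (rest-transfer last-transfer)
    where
    rest-transfer : ∀ {z z′} → w (fromℕ n) z ≤ z′ →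
                    ∀ k → w (inject₁ k) (restSol η g z k) ≤ restSol η g′ z′ k
    rest-transfer wz≤z′ =
      sol-transfer {η = η ∘ inject₁} {w = w ∘ inject₁}
        (substLast-mono g-mono _) (substLast-mono g′-mono _)
        (w-mono ∘ inject₁) (w-inductive ∘ inject₁) (substLast-simulation {w = w} g≲g′ wz≤z′)
    last-transfer : w (fromℕ n) (lastSol η g) ≤ lastSol η g′
    last-transfer =
      fixpoint-transfer (η (fromℕ n)) (w-mono _) (w-inductive _) (lastRhs-mono η g-mono)
        (lastRhs-mono η g′-mono)
        (λ wz≤z′ → g≲g′ (fromℕ n)
                     (snoc-pointwise (λ k a b → w k a ≤ b) wz≤z′ (rest-transfer wz≤z′)))

  sol-mono-upTo : ∀ {n η} {g g′ : System n} {u : Fin n → Carrier → Carrier} → g ⊑ g → g′ ⊑ g′ →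
                  (∀ i → Monotone L (u i)) → (∀ i → η i ≡ μ → LfpInductive (u i)) →
                  Simulation u g′ g′ → (∀ i x → u i (g i x) ≤ g i x) →
                  (∀ i {x} → Closed u x → g i x ≤ g′ i x) → sol L n η g ≤ⁿ sol L n η g′
  sol-mono-upTo {zero} _ _ _ _ _ _ _ ()
  sol-mono-upTo {suc n} {η} {g} {g′} {u} g-mono g′-mono u-mono u-inductive g′≲g′ g-closed g≤g′ =
    snoc-pointwise (λ _ → _≤_) last≤ (λ k → trans (rest≤ s-closed k) (restSol-mono η g′-mono last≤ k))
    where
    top = fromℕ n
    snoc-closed : ∀ {x z} → Closed (u ∘ inject₁) x → u top z ≤ z → Closed u (snoc L x z)
    snoc-closed x-closed z-closed = snoc-all (λ k a → u k a ≤ a) z-closed x-closed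
    restSol-closed : ∀ z → Closed (u ∘ inject₁) (restSol η g z)
    restSol-closed z = sol-closed (substLast-mono g-mono z) (u-mono ∘ inject₁)
                         (λ i x → g-closed (inject₁ i) (snoc L x z))
    rest≤ : ∀ {z} → u top z ≤ z → restSol η g z ≤ⁿ restSol η g′ z
    rest≤ {z} z-closed =
      sol-mono-upTo {η = η ∘ inject₁} (substLast-mono g-mono z) (substLast-mono g′-mono z)
        (u-mono ∘ inject₁) (u-inductive ∘ inject₁) (substLast-simulation {w = u} g′≲g′ z-closed)
        (λ i x → g-closed (inject₁ i) (snoc L x z))
        (λ i x-closed → g≤g′ (inject₁ i) (snoc-closed x-closed z-closed))
    lastRhs≤ : ∀ z → u top z ≤ z → lastRhs η g z ≤ lastRhs η g′ z
    lastRhs≤ z z-closed =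
      trans (g≤g′ top (snoc-closed (restSol-closed z) z-closed))
            (g′-mono top (snoc-pointwise (λ _ → _≤_) refl (rest≤ z-closed)))
    lastSol-closed : ∀ h → Closed u (sol L (suc n) η h) → u top (lastSol η h) ≤ lastSol η h
    lastSol-closed h h-sol-closed = ≡.subst (λ a → u top a ≤ a) (sol-last η h) (h-sol-closed top)
    s-closed : u top (lastSol η g) ≤ lastSol η g
    s-closed = lastSol-closed g (sol-closed {η = η} g-mono u-mono g-closed)
    s′-closed : u top (lastSol η g′) ≤ lastSol η g′
    s′-closed = lastSol-closed g′ (sol-transfer {η = η} g′-mono g′-mono u-mono u-inductive g′≲g′)
    last≤ : lastSol η g ≤ lastSol η g′
    last≤ = fixpoint-mono-on (η top) (λ z → u top z ≤ z) (lastRhs-mono η g-mono) (lastRhs-mono η g′-mono)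
              lastRhs≤ s-closed s′-closed

  sol-decoupled : ∀ {n η} {g : System n} (h : Fin n → Carrier → Carrier) →
                  (∀ i x → g i x ≈ h i (x i)) → ∀ k → sol L n η g k ≈ fixpoint L (η k) (h k)
  sol-decoupled {zero} _ _ ()
  sol-decoupled {suc n} {η} {g} h g≈h =
    snoc-all (λ k a → a ≈ fixpoint L (η k) (h k))
      (fixpoint-cong (η (fromℕ n)) λ z →
         Eq.trans (g≈h (fromℕ n) _)
                  (Eq.reflexive (≡.cong (h (fromℕ n)) (snoc-last (restSol η g z) z))))
      (sol-decoupled {η = η ∘ inject₁} (h ∘ inject₁) λ i x →
         Eq.trans (g≈h (inject₁ i) _) (Eq.reflexive (≡.cong (h (inject₁ i)) (snoc-inject₁ x _ i))))

  sol-cast : ∀ {n N} (e : n ≡ N) {η : Fin N → FP} {g : System N} → g ⊑ g → ∀ k →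
             sol L N η g k ≈
             sol L n (η ∘ cast e) (λ j v → g (cast e j) (v ∘ cast (≡.sym e))) (cast (≡.sym e) k)
  sol-cast ≡.refl {η} {g} g-mono k =
    ≡.subst (λ k′ → sol L _ η g k ≈ sol L _ _ _ k′) (≡.sym (cast-is-id ≡.refl k))
      (sol-cong (≡.cong η ∘ ≡.sym ∘ cast-is-id ≡.refl) g-mono
         (λ j x → rhs-cong g-mono (≡.sym (cast-is-id ≡.refl j))
                    (Eq.reflexive ∘ ≡.cong x ∘ ≡.sym ∘ cast-is-id ≡.refl)) k)

module Blocks {c ℓ₁ ℓ₂ : Level} (L : CompleteLattice c ℓ₁ ℓ₂) (a : ℕ) where
  open CompleteLattice L
  open Fixpoints L
  open Solutions L

  leftSystem : ∀ {b} → System (a + b) → Vector Carrier b → System a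
  leftSystem {b} g x i y = g (i ↑ˡ b) (y ++ x)

  solveLeft : ∀ {b} → (Fin (a + b) → FP) → System (a + b) → Vector Carrier b → Vector Carrier a
  solveLeft {b} η g x = sol L a (η ∘ (_↑ˡ b)) (leftSystem g x)

  eliminateLeft : ∀ {b} → (Fin (a + b) → FP) → System (a + b) → System b
  eliminateLeft η g j x = g (a ↑ʳ j) (solveLeft η g x ++ x)

  solveRight : ∀ {b} → (Fin (a + b) → FP) → System (a + b) → Vector Carrier b
  solveRight {b} η g = sol L b (η ∘ (a ↑ʳ_)) (eliminateLeft η g)

  leftSystem-mono : ∀ {b} {g : System (a + b)} → g ⊑ g →
                    ∀ {x x′} → x ≤ⁿ x′ → leftSystem g x ⊑ leftSystem g x′
  leftSystem-mono {b} g-mono x≤x′ i y≤y′ = g-mono (i ↑ˡ b) (++⁺ _≤_ y≤y′ x≤x′)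

  module _ {b} (η : Fin (a + b) → FP) {g : System (a + b)} (g-mono : g ⊑ g) where

    solveLeft-mono : ∀ {x x′} → x ≤ⁿ x′ → solveLeft η g x ≤ⁿ solveLeft η g x′
    solveLeft-mono x≤x′ = sol-mono (λ _ → ≡.refl) (leftSystem-mono g-mono x≤x′)

    solveLeft-cong : ∀ {x x′} → x ≈ⁿ x′ → solveLeft η g x ≈ⁿ solveLeft η g x′
    solveLeft-cong x≈x′ i =
      antisym (solveLeft-mono (reflexive ∘ x≈x′) i) (solveLeft-mono (reflexive ∘ Eq.sym ∘ x≈x′) i)

    eliminateLeft-mono : eliminateLeft η g ⊑ eliminateLeft η g
    eliminateLeft-mono j x≤y = g-mono (a ↑ʳ j) (++⁺ _≤_ (solveLeft-mono x≤y) x≤y)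

  SolvedByBlocks : ℕ → Set (c ⊔ ℓ₁ ⊔ ℓ₂)
  SolvedByBlocks b = ∀ {η : Fin (a + b) → FP} {g : System (a + b)} → g ⊑ g →
                     sol L (a + b) η g ≈ⁿ (solveLeft η g (solveRight η g) ++ solveRight η g)

  module EmptyRight {η : Fin (a + 0) → FP} {g : System (a + 0)} (g-mono : g ⊑ g) where

    e : a ≡ a + 0
    e = ≡.sym (+-identityʳ a)

    cast-↑ˡ : ∀ i → cast e i ≡ i ↑ˡ 0
    cast-↑ˡ i = cast-toℕ e (≡.sym (toℕ-↑ˡ i 0))

    ++-empty : ∀ (y : Vector Carrier a) (x : Vector Carrier 0) k → y (cast (≡.sym e) k) ≡ (y ++ x) k
    ++-empty y x k = ≡.trans (≡.sym (lookup-++ˡ y x _))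
      (≡.cong (y ++ x) (toℕ-injective (≡.trans (toℕ-↑ˡ _ 0) (toℕ-cast _ k))))

    sol-++-empty : sol L (a + 0) η g ≈ⁿ (solveLeft η g (solveRight η g) ++ solveRight η g)
    sol-++-empty k =
      Eq.trans (sol-cast e g-mono k)
        (Eq.trans (sol-cong (≡.cong η ∘ cast-↑ˡ) (λ j x≤y → g-mono (cast e j) (x≤y ∘ cast (≡.sym e)))
                     (λ j y → rhs-cong g-mono (cast-↑ˡ j) (Eq.reflexive ∘ ++-empty y _)) _)
                  (Eq.reflexive (++-empty _ _ k)))

  -- Induction step over b: reindexing Fin (a + suc b) as Fin (suc (a + b)) lets sol
  -- peel the last variable of the right block.
  module PeelRight (b : ℕ) (ih : SolvedByBlocks b)
                   {η : Fin (a + suc b) → FP} {g : System (a + suc b)} (g-mono : g ⊑ g) where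

    e : suc (a + b) ≡ a + suc b
    e = ≡.sym (+-suc a b)

    ι : Fin (suc (a + b)) → Fin (a + suc b)
    ι = cast e

    κ : Fin (a + suc b) → Fin (suc (a + b))
    κ = cast (≡.sym e)

    ι-inject₁-↑ˡ : ∀ i → ι (inject₁ (i ↑ˡ b)) ≡ i ↑ˡ suc b
    ι-inject₁-↑ˡ i = cast-toℕ e
      (≡.trans (toℕ-inject₁ _) (≡.trans (toℕ-↑ˡ i b) (≡.sym (toℕ-↑ˡ i (suc b)))))

    ι-inject₁-↑ʳ : ∀ j → ι (inject₁ (a ↑ʳ j)) ≡ a ↑ʳ inject₁ j
    ι-inject₁-↑ʳ j = cast-toℕ e
      (≡.trans (toℕ-inject₁ _) (≡.trans (toℕ-↑ʳ a j)
        (≡.trans (≡.cong (a +_) (≡.sym (toℕ-inject₁ j))) (≡.sym (toℕ-↑ʳ a (inject₁ j))))))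

    ι-fromℕ : ι (fromℕ (a + b)) ≡ a ↑ʳ fromℕ b
    ι-fromℕ = cast-toℕ e
      (≡.trans (toℕ-fromℕ _) (≡.trans (≡.cong (a +_) (≡.sym (toℕ-fromℕ b))) (≡.sym (toℕ-↑ʳ a (fromℕ b)))))

    snoc-++ : ∀ (y : Vector Carrier a) x z k → snoc L (y ++ x) z (κ k) ≡ (y ++ snoc L x z) k
    snoc-++ y x z k =
      ≡.trans (snoc-all (λ k′ v → v ≡ (y ++ snoc L x z) (ι k′)) last-case
                        (↑-elim a _ left-case right-case) (κ k))
              (≡.cong (y ++ snoc L x z) (cast-involutive e (≡.sym e) k))
      where
      last-case : z ≡ (y ++ snoc L x z) (ι (fromℕ (a + b)))
      last-case = ≡.sym (≡.trans (≡.cong (y ++ snoc L x z) ι-fromℕ)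
                                 (≡.trans (lookup-++ʳ y _ (fromℕ b)) (snoc-last x z)))
      left-case : ∀ i → (y ++ x) (i ↑ˡ b) ≡ (y ++ snoc L x z) (ι (inject₁ (i ↑ˡ b)))
      left-case i = ≡.trans (lookup-++ˡ y x i)
        (≡.sym (≡.trans (≡.cong (y ++ snoc L x z) (ι-inject₁-↑ˡ i)) (lookup-++ˡ y _ i)))
      right-case : ∀ j → (y ++ x) (a ↑ʳ j) ≡ (y ++ snoc L x z) (ι (inject₁ (a ↑ʳ j)))
      right-case j = ≡.trans (lookup-++ʳ y x j)
        (≡.sym (≡.trans (≡.cong (y ++ snoc L x z) (ι-inject₁-↑ʳ j))
                        (≡.trans (lookup-++ʳ y _ (inject₁ j)) (snoc-inject₁ x z j))))

    η* : Fin (suc (a + b)) → FP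
    η* = η ∘ ι

    g* : System (suc (a + b))
    g* j v = g (ι j) (v ∘ κ)

    g*-mono : g* ⊑ g*
    g*-mono j x≤y = g-mono (ι j) (x≤y ∘ κ)

    ηʳ : Fin (suc b) → FP
    ηʳ = η ∘ (a ↑ʳ_)

    gʳ : System (suc b)
    gʳ = eliminateLeft η g

    R : Carrier → Vector Carrier b
    R = restSol ηʳ gʳ

    solveLeft-substLast : ∀ z x → solveLeft (η* ∘ inject₁) (substLast L g* z) x ≈ⁿ solveLeft η g (snoc L x z)
    solveLeft-substLast z x =
      sol-cong (≡.cong η ∘ ι-inject₁-↑ˡ) (leftSystem-mono (substLast-mono g*-mono z) (λ _ → refl))
        (λ i y → rhs-cong g-mono (ι-inject₁-↑ˡ i) (Eq.reflexive ∘ snoc-++ y x z))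

    solveRight-substLast : ∀ z → solveRight (η* ∘ inject₁) (substLast L g* z) ≈ⁿ R z
    solveRight-substLast z =
      sol-cong (≡.cong η ∘ ι-inject₁-↑ʳ) (eliminateLeft-mono (η* ∘ inject₁) (substLast-mono g*-mono z))
        (λ j x → rhs-cong g-mono (ι-inject₁-↑ʳ j) λ k →
           Eq.trans (Eq.reflexive (snoc-++ _ x z k)) (++⁺ _≈_ (solveLeft-substLast z x) (λ _ → Eq.refl) k))

    snoc-restSol* : ∀ z k → snoc L (restSol η* g* z) z (κ k) ≈
                            (solveLeft η g (snoc L (R z) z) ++ snoc L (R z) z) k
    snoc-restSol* z k =
      Eq.trans (snoc-pointwise (λ _ → _≈_) Eq.refl restSol*≈ (κ k)) (Eq.reflexive (snoc-++ _ (R z) z k))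
      where
      R≈ : solveRight (η* ∘ inject₁) (substLast L g* z) ≈ⁿ R z
      R≈ = solveRight-substLast z
      restSol*≈ : restSol η* g* z ≈ⁿ (solveLeft η g (snoc L (R z) z) ++ R z)
      restSol*≈ k′ = Eq.trans (ih {η* ∘ inject₁} (substLast-mono g*-mono z) k′)
        (++⁺ _≈_ (λ i → Eq.trans (solveLeft-substLast z _ i)
                                 (solveLeft-cong η g-mono (snoc-pointwise (λ _ → _≈_) Eq.refl R≈) i))
                 R≈ k′)

    lastSol* : lastSol η* g* ≈ lastSol ηʳ gʳ
    lastSol* = ≡.subst (λ e′ → lastSol η* g* ≈ fixpoint L e′ (lastRhs ηʳ gʳ)) (≡.cong η ι-fromℕ)
      (fixpoint-cong (η* (fromℕ (a + b))) λ z → rhs-cong g-mono ι-fromℕ (snoc-restSol* z))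

    sol-++-suc : sol L (a + suc b) η g ≈ⁿ (solveLeft η g (solveRight η g) ++ solveRight η g)
    sol-++-suc k = Eq.trans (sol-cast e g-mono k)
      (Eq.trans (snoc-restSol* _ k) (++⁺ _≈_ (solveLeft-cong η g-mono lastSols≈) lastSols≈ k))
      where
      lastSols≈ : snoc L (R (lastSol η* g*)) (lastSol η* g*) ≈ⁿ solveRight η g
      lastSols≈ = snoc-pointwise (λ _ → _≈_) lastSol*
                    (restSol-cong ηʳ (eliminateLeft-mono η g-mono) lastSol*)

  sol-++ : ∀ b → SolvedByBlocks b
  sol-++ zero    = EmptyRight.sol-++-empty
  sol-++ (suc b) = PeelRight.sol-++-suc b (sol-++ b)

module UpTo {c ℓ₁ ℓ₂ : Level} (L : CompleteLattice c ℓ₁ ℓ₂) {m : ℕ} {η : Fin m → FP}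
            {f : Solutions.System L m}
            {u : Fin m → CompleteLattice.Carrier L → CompleteLattice.Carrier L}
            (f-mono : ∀ i → MonotoneN L (f i)) (compatible : Compatible L m η f u) where
  open CompleteLattice L
  open Compatible compatible
  open Fixpoints L
  open Solutions L
  open Blocks L m

  u-inductive : ∀ i → η i ≡ μ → LfpInductive (u i)
  u-inductive i ηi≡μ = continuous-strict⇒lfpInductive (u-mono i) (u-cont i ηi≡μ) (u-strict i ηi≡μ)

  f-simulation : Simulation u f f
  f-simulation i ux≤y = trans (compat _ i) (f-mono i ux≤y)

  sol-closed-compatible : Closed u (sol L m η f)
  sol-closed-compatible = sol-transfer f-mono f-mono u-mono u-inductive f-simulation

  fᶜ : System m
  fᶜ i x = f i (λ j → closure (u j) (x j))

  sol-upToClosure : sol L m η fᶜ ≈ⁿ sol L m η f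
  sol-upToClosure k =
    antisym (sol-mono-upTo fᶜ-mono f-mono u-mono u-inductive f-simulation fᶜ-closed fᶜ≤f k)
            (sol-mono (λ _ → ≡.refl) f⊑fᶜ k)
    where
    fᶜ-mono : fᶜ ⊑ fᶜ
    fᶜ-mono i x≤y = f-mono i (closure-mono ∘ x≤y)
    fᶜ-closed : ∀ i x → u i (fᶜ i x) ≤ fᶜ i x
    fᶜ-closed i x = f-simulation i (λ j → closure-closed (u-mono j) (x j))
    fᶜ≤f : ∀ i {x} → Closed u x → fᶜ i x ≤ f i x
    fᶜ≤f i x-closed = f-mono i (λ j → closure-least refl (x-closed j))
    f⊑fᶜ : f ⊑ fᶜ
    f⊑fᶜ i x≤y = f-mono i (λ j → trans (x≤y j) (closure-inflationary (u-mono j) _))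

  ηᵘ : Fin (m + m) → FP
  ηᵘ = upη L m η

  fᵘ : System (m + m)
  fᵘ = upf L m f u

  fᵘ-mono : fᵘ ⊑ fᵘ
  fᵘ-mono k x≤y with splitAt m k
  ... | inj₁ i = ∨-mono (u-mono i (x≤y _)) (x≤y _)
  ... | inj₂ j = f-mono j (x≤y ∘ (_↑ˡ m))

  ηᵘ-↑ˡ : ∀ i → ηᵘ (i ↑ˡ m) ≡ μ
  ηᵘ-↑ˡ i rewrite splitAt-↑ˡ m i m = ≡.refl

  ηᵘ-↑ʳ : ∀ j → ηᵘ (m ↑ʳ j) ≡ η j
  ηᵘ-↑ʳ j rewrite splitAt-↑ʳ m m j = ≡.refl

  fᵘ-↑ˡ : ∀ i v → fᵘ (i ↑ˡ m) v ≡ u i (take m v i) ∨ drop m v i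
  fᵘ-↑ˡ i v rewrite splitAt-↑ˡ m i m = ≡.refl

  fᵘ-↑ʳ : ∀ j v → fᵘ (m ↑ʳ j) v ≡ f j (take m v)
  fᵘ-↑ʳ j v rewrite splitAt-↑ʳ m m j = ≡.refl

  solveLeft-fᵘ : ∀ x → solveLeft ηᵘ fᵘ x ≈ⁿ (λ i → closure (u i) (x i))
  solveLeft-fᵘ x i =
    ≡.subst (λ e → solveLeft ηᵘ fᵘ x i ≈ fixpoint L e (λ z → u i z ∨ x i)) (ηᵘ-↑ˡ i)
      (sol-decoupled (λ i z → u i z ∨ x i)
        (λ i y → Eq.reflexive (≡.trans (fᵘ-↑ˡ i (y ++ x))
                   (≡.cong₂ (λ a b → u i a ∨ b) (lookup-++ˡ y x i) (lookup-++ʳ y x i)))) i)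

  solveRight-fᵘ : solveRight ηᵘ fᵘ ≈ⁿ sol L m η fᶜ
  solveRight-fᵘ = sol-cong ηᵘ-↑ʳ (eliminateLeft-mono ηᵘ fᵘ-mono) λ j x →
    Eq.trans (Eq.reflexive (fᵘ-↑ʳ j _))
             (rhs-cong f-mono ≡.refl (λ i → Eq.trans (Eq.reflexive (lookup-++ˡ _ x i)) (solveLeft-fᵘ x i)))

theorem7p4 : {c ℓ₁ ℓ₂ : Level} (L : CompleteLattice c ℓ₁ ℓ₂) →
    let open CompleteLattice L in
    (m : ℕ) (η : Fin m → FP) (f : Fin m → Vector Carrier m → Carrier) →
    (∀ i → MonotoneN L (f i)) →
    (u : Fin m → Carrier → Carrier) →
    Compatible L m η f u →
    ∀ (k : Fin (m + m)) →
    sol L (m + m) (upη L m η) (upf L m f u) k ≈ (sol L m η f ++ sol L m η f) k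
theorem7p4 L m η f f-mono u compatible k =
  Eq.trans (sol-++ m fᵘ-mono k) (++⁺ _≈_ left-block right-block k)
  where
  open CompleteLattice L
  open Fixpoints L
  open Solutions L
  open Blocks L m
  open UpTo L f-mono compatible
  open Compatible compatible using (u-mono)

  right-block : solveRight ηᵘ fᵘ ≈ⁿ sol L m η f
  right-block i = Eq.trans (solveRight-fᵘ i) (sol-upToClosure i)

  left-block : solveLeft ηᵘ fᵘ (solveRight ηᵘ fᵘ) ≈ⁿ sol L m η f
  left-block i = Eq.trans (solveLeft-fᵘ _ i)
    (Eq.trans (closure-cong (right-block i)) (closure-of-closed (u-mono i) (sol-closed-compatible i)))
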